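{- Consider $\eta\in A^L$ and suppose $\eta_{\mathrm C(\varepsilon,\varepsilon)}=\mathsf{sea}$. Then $\eta\in\Omega_{\mathsf{sea}}$ if and only if the following holds: - $\eta_{\mathrm C(u,v)}=\mathsf{sea}$ for all $u,v\in(\mathbb Z/2)^*$; - for all $u\in(\mathbb Z/2)^*$ there exist $s_{u,\nwarrow}$ and $s_{u,\nearrow}$ in $(\mathbb Z/2)^{\mathbb N}$ with $(s_{u,\nwarrow})_0\neq(s_{u,\nearrow})_0$, and $s_{u,\swarrow}$ and $s_{u,\searrow}$ in $(\mathbb Z/2)^{ -\mathbb N}$ with $(s_{u,\swarrow})_0\neq(s_{u,\searrow})_0$, such that $\eta_{\mathrm U(u,v,w)}={\nwarrow}$ if $|v|>0$ and $v\sqsubset s_{u,\nwarrow}$; $\eta_{\mathrm U(u,v,w)}={\nearrow}$ if $|v|>0$ and $v\sqsubset s_{u,\nearrow}$; $\eta_{\mathrm U(u,v,w)}={\uparrow}$ if $|v|>0$ and the previous two cases do not apply; $\eta_{\mathrm D(w,v,u)}={\swarrow}$ if $|v|>0$ and $v\sqsubset s_{u,\swarrow}$; $\eta_{\mathrm D(w,v,u)}={\searrow}$ if $|v|>0$ and $v\sqsubset s_{u,\searrow}$; $\eta_{\mathrm D(w,v,u)}={\downarrow}$ if $|v|>0$ and the previous two cases do not apply. A configuration $\eta$ with $\eta_{\mathrm C(\varepsilon,\varepsilon)}=\mathsf{sea}$ is fully determined by the collection, for all $u\in(\mathbb Z/2)^*$, of the words $s_{u,\nwarrow},s_{u,\nearrow}\in(\mathbb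 Z/2)^{\mathbb N}$ and $s_{u,\swarrow},s_{u,\searrow}\in(\mathbb Z/2)^{ -\mathbb N}$.
   Context: $L=\mathbb Z/2\wr\mathbb Z$ with elements $(s,n)$, $s\colon\mathbb Z+\tfrac12\to\mathbb Z/2$ finitely supported, product $(r,m)(s,n)=(t,m+n)$, $t_i=r_i+s_{i-m}$; $a=(0,1)$, $b=(\delta_{1/2},1)$. For finite words $u,v,w$ over $\{0,1\}$: $\mathrm C(u,v)$ is the element $(s,0)$ whose lamps at positions $-|u|+\tfrac12,\dots,-\tfrac12$ read $u$ and at $\tfrac12,\dots,|v|-\tfrac12$ read $v$ (others $0$); in particular $\mathrm C(\varepsilon,\varepsilon)=1$. $\mathrm U(u,v,w)$ is the element $(s,|v|)$ with $u$ at positions $-|u|+\tfrac12,\dots,-\tfrac12$, $v$ at $\tfrac12,\dots,|v|-\tfrac12$, $w$ at $|v|+\tfrac12,\dots,|v|+|w|-\tfrac12$. $\mathrm D(w,v,u)$ is the element $(s,-|v|)$ with $w$ at positions $-|v|-|w|+\tfrac12,\dots,-|v|-\tfrac12$, $v$ at $-|v|+\tfrac12,\dots,-\tfrac12$, $u$ at $\tfrac12,\dots,|u|-\tfrac12$. For $s=s_0s_1\cdots\in(\mathbb Z/2)^{\mathbb N}$, $v\sqsubset s$ means $v$ is a prefix $s_0\cdots s_{|v|-1}$; for $s=\cdots s_{ -1}s_0\in(\mathbb Z/2)^{ -\mathbb N}$ it means $v$ is a suffix $s_{ -|v|+1}\cdots s_0$. $U=\{\nwarrow,\uparrow,\nearrow\}$,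 $D=\{\swarrow,\downarrow,\searrow\}$, $A=U\cup\{\mathsf{sea}\}\cup D$, where $\mathsf{sea}$ is the "sea level" symbol (the Aquarius sign in the paper); $\phi(U)=1$, $\phi(\mathsf{sea})=0$, $\phi(D)=-1$. $\Omega_{\mathsf{sea}}\subseteq A^L$ consists of $\eta$ such that for all $g\in L$, $(\alpha,\beta,\gamma,\delta)=(\eta_g,\eta_{gab^{ -1}},\eta_{ga},\eta_{gb})$ satisfies: (1) $\phi(\alpha)=\phi(\beta)$ and $\phi(\gamma)=\phi(\delta)$; (2) $\phi(\gamma)-\phi(\alpha)\in\{0,1\}$; (3) $\alpha=\mathsf{sea}\Rightarrow\{\gamma,\delta\}=\{\nwarrow,\nearrow\}$; (4) $\gamma=\mathsf{sea}\Rightarrow\{\alpha,\beta\}=\{\swarrow,\searrow\}$; (5) $\alpha\in U\Rightarrow\beta=\alpha\wedge\{\gamma,\delta\}=\{\uparrow,\alpha\}$; (6) $\gamma\in D\Rightarrow\delta=\gamma\wedge\{\alpha,\beta\}=\{\downarrow,\gamma\}$. -}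

module Defs where

open import Data.Bool using (Bool; true; false; _xor_; if_then_else_)
open import Data.Nat as ℕ using (ℕ; zero; suc; _<_)
open import Data.Integer as ℤ using (ℤ; +_; -[1+_]; ∣_∣)
open import Data.List using (List; []; _∷_; length; map; reverse; _++_; upTo; lookup)
open import Data.Maybe using (Maybe; just; nothing)
open import Data.Fin using (Fin; toℕ)
open import Data.Product using (Σ; _×_; _,_)
open import Data.Sum using (_⊎_)
open import Function.Bundles using (_⇔_)
open import Relation.Binary.PropositionalEquality using (_≡_; _≢_)
open import Relation.Nullary using (¬_)

-- ℤ/2 is Bool (addition = xor).
-- A finitely supported half-infinite bit string b₀ b₁ b₂ … is encoded
-- canonically: `nothing` = all zeros, `just w` = w ++ 1 ++ 0 0 0 …

Half : Set
Half = Maybe (List Bool)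

norm : List Bool → Half
norm [] = nothing
norm (b ∷ bs) with norm bs
... | just w  = just (b ∷ w)
... | nothing = if b then just [] else nothing

at : Half → ℕ → Bool
at nothing _ = false
at (just []) zero = true
at (just []) (suc _) = false
at (just (b ∷ w)) zero = b
at (just (b ∷ w)) (suc k) = at (just w) k

size : Half → ℕ
size nothing = 0
size (just w) = suc (length w)

-- A finitely supported s : ℤ + 1/2 → ℤ/2.  The position k + 1/2 is
-- indexed by k : ℤ.  `right` lists s at 1/2, 3/2, 5/2, …;
-- `left` lists s at -1/2, -3/2, -5/2, …
record Lamps : Set where
  constructor lamps
  field
    right : Half
    left  : Half
open Lamps public

lampAt : Lamps → ℤ → Bool
lampAt s (+ k)     = at (right s) k
lampAt s -[1+ k ]  = at (left s) k

bound : Lamps → ℕ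
bound s = size (right s) ℕ.+ size (left s)

fromFun : ℕ → (ℤ → Bool) → Lamps
fromFun N f = lamps (norm (map (λ k → f (+ k)) (upTo N)))
                    (norm (map (λ k → f -[1+ k ]) (upTo N)))

record L : Set where
  constructor ⟨_,_⟩
  field
    lp  : Lamps
    pos : ℤ

-- (r,m)(s,n) = (t, m+n), t_i = r_i + s_{i-m}
-- (the bound covers the support of t, so fromFun loses nothing)
_·_ : L → L → L
⟨ r , m ⟩ · ⟨ s , n ⟩ =
  ⟨ fromFun (bound r ℕ.+ bound s ℕ.+ ∣ m ∣)
            (λ i → lampAt r i xor lampAt s (i ℤ.- m)) , m ℤ.+ n ⟩

inv : L → L
inv ⟨ s , n ⟩ = ⟨ fromFun (bound s ℕ.+ ∣ n ∣) (λ j → lampAt s (j ℤ.+ n)) , ℤ.- n ⟩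

-- a = (0,1), b = (δ_{1/2},1)
a : L
a = ⟨ lamps nothing nothing , + 1 ⟩

b : L
b = ⟨ lamps (just []) nothing , + 1 ⟩

-- lamps at -|u|+1/2 … -1/2 read u, at 1/2 … |v|-1/2 read v
C : List Bool → List Bool → L
C u v = ⟨ lamps (norm v) (norm (reverse u)) , + 0 ⟩

-- position |v|; u at -|u|+1/2 … -1/2, v then w from 1/2 on
U : List Bool → List Bool → List Bool → L
U u v w = ⟨ lamps (norm (v ++ w)) (norm (reverse u)) , + length v ⟩

-- position -|v|; w then v at -|v|-|w|+1/2 … -1/2, u from 1/2 on
D : List Bool → List Bool → List Bool → L
D w v u = ⟨ lamps (norm u) (norm (reverse (w ++ v))) , ℤ.- (+ length v) ⟩

e : L
e = C [] []

data A : Set where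
  nw up ne sea sw down se : A

φ : A → ℤ
φ nw   = + 1
φ up   = + 1
φ ne   = + 1
φ sea  = + 0
φ sw   = ℤ.- (+ 1)
φ down = ℤ.- (+ 1)
φ se   = ℤ.- (+ 1)

InU : A → Set
InU x = x ≡ nw ⊎ x ≡ up ⊎ x ≡ ne

InD : A → Set
InD x = x ≡ sw ⊎ x ≡ down ⊎ x ≡ se

PairEq : A → A → A → A → Set
PairEq γ δ x y = (γ ≡ x × δ ≡ y) ⊎ (γ ≡ y × δ ≡ x)

LocalRule : A → A → A → A → Set
LocalRule α β γ δ =
  (φ α ≡ φ β × φ γ ≡ φ δ)
  × (φ γ ℤ.- φ α ≡ + 0 ⊎ φ γ ℤ.- φ α ≡ + 1)
  × (α ≡ sea → PairEq γ δ nw ne)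
  × (γ ≡ sea → PairEq α β sw se)
  × (InU α → β ≡ α × PairEq γ δ up α)
  × (InD γ → δ ≡ γ × PairEq α β down γ)

Config : Set
Config = L → A

InΩ : Config → Set
InΩ η = ∀ g → LocalRule (η g) (η ((g · a) · inv b)) (η (g · a)) (η (g · b))

-- One-sided infinite words.
-- (ℤ/2)^ℕ  : s₀ s₁ s₂ …  represented as s : ℕ → Bool.
-- (ℤ/2)^{-ℕ} : … s₋₂ s₋₁ s₀ represented as t : ℕ → Bool with t k = s_{-k}.

Prefix : List Bool → (ℕ → Bool) → Set
Prefix v s = ∀ (i : Fin (length v)) → lookup v i ≡ s (toℕ i)

-- v ⊏ s for s ∈ (ℤ/2)^{-ℕ}: v = s_{-|v|+1} … s₀
Suffix : List Bool → (ℕ → Bool) → Set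
Suffix v t = Prefix (reverse v) t

record Words : Set where
  field
    snw sne : ℕ → Bool
    ssw sse : ℕ → Bool
open Words public

Rules : Config → List Bool → Words → Set
Rules η u S =
  (∀ v w → 0 < length v → Prefix v (snw S) → η (U u v w) ≡ nw)
  × (∀ v w → 0 < length v → Prefix v (sne S) → η (U u v w) ≡ ne)
  × (∀ v w → 0 < length v → ¬ Prefix v (snw S) → ¬ Prefix v (sne S)
       → η (U u v w) ≡ up)
  × (∀ v w → 0 < length v → Suffix v (ssw S) → η (D w v u) ≡ sw)
  × (∀ v w → 0 < length v → Suffix v (sse S) → η (D w v u) ≡ se)
  × (∀ v w → 0 < length v → ¬ Suffix v (ssw S) → ¬ Suffix v (sse S)
       → η (D w v u) ≡ down)

Characterization : Config → Set
Characterization η =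
  (∀ u v → η (C u v) ≡ sea)
  × (∀ u → Σ Words λ S → snw S 0 ≢ sne S 0 × ssw S 0 ≢ sse S 0 × Rules η u S)

-- Flipping a lamp at or beyond the lamplighter does not change a symbol at or
-- above sea level: the two cells above the two configurations have the same tops
-- by induction, and the tops of a tile above sea level determine its bottom.
-- Hence sea at the identity spreads to all of height 0 (the left lamps are handled
-- by the reflection that exchanges the two sides and turns the arrows upside down),
-- and above a fixed left word u the symbols form a binary tree of tiles rooted at
-- sea level, indexed by the lamps v between the origin and the lamplighter. In such
-- a tree the ↖-nodes form one infinite ray, and so do the ↗-nodes; these rays are
-- s_{u,↖} and s_{u,↗}, and all other nodes carry ↑. Conversely the labelling given by
-- any two rays with different first letters is tiled, and the lower half-space is the
-- mirror image of the upper one.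
module Submission where

open import Defs
open import Data.Bool using (Bool; true; false; not; _xor_; _∧_; if_then_else_)
open import Data.Bool.Properties using (xor-identityʳ; xor-comm; true-xor)
  renaming (_≟_ to _≟ᵇ_)
open import Data.Empty using (⊥-elim)
import Data.Fin as Fin
open import Data.Integer as ℤ using (ℤ; +_; -[1+_]; ∣_∣; _⊖_)
import Data.Integer.Properties as ℤ
open import Data.List using (List; []; _∷_; _∷ʳ_; _++_; length; map; reverse; applyUpTo; upTo)
import Data.List.Properties as List
open import Data.List.Reverse using (Reverse; []; _∶_∶ʳ_; reverseView)
open import Data.Maybe using (just; nothing)
open import Data.Nat as ℕ using (ℕ; zero; suc; _≤_; _<_; z≤n; s≤s)
import Data.Nat.Properties as ℕ
open import Data.Product using (Σ; ∃-syntax; _×_; _,_; proj₁; proj₂)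
open import Data.Sum using (_⊎_; inj₁; inj₂)
open import Function.Base using (_∘_)
open import Function.Bundles using (_⇔_; mk⇔; Equivalence)
open import Relation.Binary.Definitions using (DecidableEquality)
open import Relation.Binary.PropositionalEquality
open import Relation.Nullary using (¬_; Dec; does; yes; no)
open import Relation.Nullary.Decidable using (does-⇔; map′; _×-dec_; dec-true; dec-false)


at-norm-head : ∀ c xs → at (norm (c ∷ xs)) 0 ≡ c
at-norm-head c xs with norm xs
... | just _  = refl
at-norm-head true  xs | nothing = refl
at-norm-head false xs | nothing = refl

at-norm-tail : ∀ c xs k → at (norm (c ∷ xs)) (suc k) ≡ at (norm xs) k
at-norm-tail c xs k with norm xs
... | just _  = refl
at-norm-tail true  xs k | nothing = refl
at-norm-tail false xs k | nothing = refl

at-beyond-size : ∀ h k → size h ≤ k → at h k ≡ false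
at-beyond-size nothing        k       _         = refl
at-beyond-size (just [])      (suc k) _         = refl
at-beyond-size (just (c ∷ w)) (suc k) (s≤s le) = at-beyond-size (just w) k le

at-norm-applyUpTo : ∀ N g → (∀ k → N ≤ k → g k ≡ false) →
                    ∀ k → at (norm (applyUpTo g N)) k ≡ g k
at-norm-applyUpTo zero    g g≡0 k       = sym (g≡0 k z≤n)
at-norm-applyUpTo (suc N) g g≡0 zero    = at-norm-head (g 0) (applyUpTo (g ∘ suc) N)
at-norm-applyUpTo (suc N) g g≡0 (suc k) =
  trans (at-norm-tail (g 0) (applyUpTo (g ∘ suc) N) k)
        (at-norm-applyUpTo N (g ∘ suc) (λ k le → g≡0 (suc k) (s≤s le)) k)

at-last : ∀ w → at (just w) (length w) ≡ true
at-last []      = refl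
at-last (c ∷ w) = at-last w

at-just-injective : ∀ w w′ → (∀ k → at (just w) k ≡ at (just w′) k) → w ≡ w′
at-just-injective []      []       _  = refl
at-just-injective []      (c ∷ w′) eq with () ← trans (eq (suc (length w′))) (at-last w′)
at-just-injective (c ∷ w) []       eq with () ← trans (sym (eq (suc (length w)))) (at-last w)
at-just-injective (c ∷ w) (c′ ∷ w′) eq =
  cong₂ _∷_ (eq 0) (at-just-injective w w′ (eq ∘ suc))

at-injective : ∀ h h′ → (∀ k → at h k ≡ at h′ k) → h ≡ h′
at-injective nothing  nothing   _  = refl
at-injective nothing  (just w′) eq with () ← trans (eq (length w′)) (at-last w′)
at-injective (just w) nothing   eq with () ← trans (sym (eq (length w))) (at-last w)
at-injective (just w) (just w′) eq = cong just (at-just-injective w w′ eq)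

norm-applyUpTo-at : ∀ h N → size h ≤ N → norm (applyUpTo (at h) N) ≡ h
norm-applyUpTo-at h N le = at-injective _ h
  (at-norm-applyUpTo N (at h) (λ k le′ → at-beyond-size h k (ℕ.≤-trans le le′)))

norm-∷ʳ-false : ∀ xs → norm (xs ∷ʳ false) ≡ norm xs
norm-∷ʳ-false [] = refl
norm-∷ʳ-false (c ∷ xs) rewrite norm-∷ʳ-false xs = refl

lampAt-injective : ∀ s t → (∀ i → lampAt s i ≡ lampAt t i) → s ≡ t
lampAt-injective (lamps r l) (lamps r′ l′) eq =
  cong₂ lamps (at-injective r r′ (eq ∘ +_)) (at-injective l l′ (eq ∘ -[1+_]))

-- The lamp at k + 1/2 and the lamp at -k - 1/2 both have offset k.
offset : ℤ → ℕ
offset (+ k)    = k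
offset -[1+ k ] = k

offset-⊖ : ∀ m n → offset (m ⊖ suc n) ≤ m ℕ.+ n
offset-⊖ zero    n       = ℕ.≤-refl
offset-⊖ (suc m) zero    = ℕ.≤-trans (ℕ.n≤1+n m) (ℕ.m≤m+n (suc m) 0)
offset-⊖ (suc m) (suc n) = begin
  offset (suc m ⊖ suc (suc n)) ≡⟨ cong offset (ℤ.[1+m]⊖[1+n]≡m⊖n m (suc n)) ⟩
  offset (m ⊖ suc n)           ≤⟨ offset-⊖ m n ⟩
  m ℕ.+ n                      ≤⟨ ℕ.+-mono-≤ (ℕ.n≤1+n m) (ℕ.n≤1+n n) ⟩
  suc m ℕ.+ suc n              ∎
  where open ℕ.≤-Reasoning

offset-+ : ∀ j m → offset (j ℤ.+ m) ≤ offset j ℕ.+ ∣ m ∣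
offset-+ (+ a)    (+ b)    = ℕ.≤-refl
offset-+ (+ a)    -[1+ b ] = ℕ.≤-trans (offset-⊖ a b) (ℕ.+-monoʳ-≤ a (ℕ.n≤1+n b))
offset-+ -[1+ a ] (+ b)    = ℕ.≤-trans (offset-⊖ b a) (ℕ.≤-reflexive (ℕ.+-comm b a))
offset-+ -[1+ a ] -[1+ b ] = ℕ.≤-reflexive (sym (ℕ.+-suc a b))

lampAt-beyond-bound : ∀ s i → bound s ≤ offset i → lampAt s i ≡ false
lampAt-beyond-bound s (+ k)    le =
  at-beyond-size (right s) k (ℕ.≤-trans (ℕ.m≤m+n _ (size (left s))) le)
lampAt-beyond-bound s -[1+ k ] le =
  at-beyond-size (left s) k (ℕ.≤-trans (ℕ.m≤n+m _ (size (right s))) le)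

lampAt-fromFun : ∀ N f → (∀ i → N ≤ offset i → f i ≡ false) →
                 ∀ i → lampAt (fromFun N f) i ≡ f i
lampAt-fromFun N f f≡0 (+ k) = begin
  at (norm (map (f ∘ +_) (upTo N))) k  ≡⟨ cong (λ xs → at (norm xs) k) (List.map-upTo (f ∘ +_) N) ⟩
  at (norm (applyUpTo (f ∘ +_) N)) k   ≡⟨ at-norm-applyUpTo N (f ∘ +_) (f≡0 ∘ +_) k ⟩
  f (+ k)                              ∎
  where open ≡-Reasoning
lampAt-fromFun N f f≡0 -[1+ k ] = begin
  at (norm (map (f ∘ -[1+_]) (upTo N))) k ≡⟨ cong (λ xs → at (norm xs) k) (List.map-upTo (f ∘ -[1+_]) N) ⟩
  at (norm (applyUpTo (f ∘ -[1+_]) N)) k  ≡⟨ at-norm-applyUpTo N (f ∘ -[1+_]) (f≡0 ∘ -[1+_]) k ⟩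
  f -[1+ k ]                              ∎
  where open ≡-Reasoning

minus-plus : ∀ i j → (i ℤ.- j) ℤ.+ j ≡ i
minus-plus i j = begin
  (i ℤ.- j) ℤ.+ j      ≡⟨ ℤ.+-assoc i (ℤ.- j) j ⟩
  i ℤ.+ (ℤ.- j ℤ.+ j)  ≡⟨ cong (λ j → i ℤ.+ j) (ℤ.+-inverseˡ j) ⟩
  i ℤ.+ + 0            ≡⟨ ℤ.+-identityʳ i ⟩
  i                    ∎
  where open ≡-Reasoning

plus-minus : ∀ i j → (i ℤ.+ j) ℤ.- j ≡ i
plus-minus i j = begin
  (i ℤ.+ j) ℤ.- j      ≡⟨ ℤ.+-assoc i j (ℤ.- j) ⟩
  i ℤ.+ (j ℤ.- j)      ≡⟨ cong (λ j → i ℤ.+ j) (ℤ.+-inverseʳ j) ⟩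
  i ℤ.+ + 0            ≡⟨ ℤ.+-identityʳ i ⟩
  i                    ∎
  where open ≡-Reasoning

-- The bound in the definition of _·_ covers the support of the product.
lampAt-· : ∀ r m s n i →
           lampAt (L.lp (⟨ r , m ⟩ · ⟨ s , n ⟩)) i ≡ lampAt r i xor lampAt s (i ℤ.- m)
lampAt-· r m s n = lampAt-fromFun (bound r ℕ.+ bound s ℕ.+ ∣ m ∣) _ outside
  where
  outside : ∀ i → bound r ℕ.+ bound s ℕ.+ ∣ m ∣ ≤ offset i →
            lampAt r i xor lampAt s (i ℤ.- m) ≡ false
  outside i le =
    cong₂ _xor_ (lampAt-beyond-bound r i (ℕ.≤-trans (ℕ.≤-trans (ℕ.m≤m+n _ (bound s)) (ℕ.m≤m+n _ ∣ m ∣)) le))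
                (lampAt-beyond-bound s (i ℤ.- m) (ℕ.+-cancelʳ-≤ ∣ m ∣ _ _ shifted))
    where
    shifted : bound s ℕ.+ ∣ m ∣ ≤ offset (i ℤ.- m) ℕ.+ ∣ m ∣
    shifted = ℕ.≤-trans (ℕ.+-monoˡ-≤ ∣ m ∣ (ℕ.m≤n+m (bound s) (bound r)))
              (ℕ.≤-trans le (subst (λ j → offset j ≤ offset (i ℤ.- m) ℕ.+ ∣ m ∣)
                                   (minus-plus i m) (offset-+ (i ℤ.- m) m)))

toggle : Lamps → ℤ → Lamps
toggle s m = L.lp (⟨ s , m ⟩ · b)

lampAt-zero : ∀ i → lampAt (lamps nothing nothing) i ≡ false
lampAt-zero (+ k)    = refl
lampAt-zero -[1+ k ] = refl

lampAt-δ₀ : ∀ i → lampAt (lamps (just []) nothing) i ≡ does (i ℤ.≟ + 0)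
lampAt-δ₀ (+ zero)  = refl
lampAt-δ₀ (+ suc k) = refl
lampAt-δ₀ -[1+ k ]  = refl

lampAt-δ₋₁ : ∀ i → lampAt (lamps nothing (just [])) i ≡ does (i ℤ.≟ -[1+ 0 ])
lampAt-δ₋₁ (+ k)          = refl
lampAt-δ₋₁ -[1+ zero ]    = refl
lampAt-δ₋₁ -[1+ suc k ]   = refl

does-shift : ∀ i j k → does (i ℤ.- j ℤ.≟ k) ≡ does (i ℤ.≟ k ℤ.+ j)
does-shift i j k = does-⇔
  (mk⇔ (λ eq → trans (sym (minus-plus i j)) (cong (ℤ._+ j) eq))
       (λ eq → trans (cong (ℤ._- j) eq) (plus-minus k j)))
  (i ℤ.- j ℤ.≟ k) (i ℤ.≟ k ℤ.+ j)

lampAt-toggle : ∀ s m i → lampAt (toggle s m) i ≡ lampAt s i xor does (i ℤ.≟ m)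
lampAt-toggle s m i = begin
  lampAt (toggle s m) i
    ≡⟨ lampAt-· s m (lamps (just []) nothing) (+ 1) i ⟩
  lampAt s i xor lampAt (lamps (just []) nothing) (i ℤ.- m)
    ≡⟨ cong (lampAt s i xor_) (lampAt-δ₀ (i ℤ.- m)) ⟩
  lampAt s i xor does (i ℤ.- m ℤ.≟ + 0)
    ≡⟨ cong (lampAt s i xor_) (does-shift i m (+ 0)) ⟩
  lampAt s i xor does (i ℤ.≟ + 0 ℤ.+ m)
    ≡⟨ cong (λ j → lampAt s i xor does (i ℤ.≟ j)) (ℤ.+-identityˡ m) ⟩
  lampAt s i xor does (i ℤ.≟ m) ∎
  where open ≡-Reasoning

·a : ∀ s m → ⟨ s , m ⟩ · a ≡ ⟨ s , m ℤ.+ + 1 ⟩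
·a s m = cong ⟨_, m ℤ.+ + 1 ⟩ (lampAt-injective _ s λ i →
  trans (lampAt-· s m (lamps nothing nothing) (+ 1) i)
        (trans (cong (lampAt s i xor_) (lampAt-zero (i ℤ.- m))) (xor-identityʳ _)))

·a·b⁻¹ : ∀ s m → (⟨ s , m ⟩ · a) · inv b ≡ ⟨ toggle s m , m ⟩
·a·b⁻¹ s m = trans (cong (_· inv b) (·a s m)) (
  cong₂ ⟨_,_⟩ (lampAt-injective _ _ λ i → begin
      lampAt (L.lp (⟨ s , m₊₁ ⟩ · inv b)) i
        ≡⟨ lampAt-· s m₊₁ (lamps nothing (just [])) -[1+ 0 ] i ⟩
      lampAt s i xor lampAt (lamps nothing (just [])) (i ℤ.- m₊₁)
        ≡⟨ cong (lampAt s i xor_) (lampAt-δ₋₁ (i ℤ.- m₊₁)) ⟩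
      lampAt s i xor does (i ℤ.- m₊₁ ℤ.≟ -[1+ 0 ])
        ≡⟨ cong (lampAt s i xor_) (does-shift i m₊₁ -[1+ 0 ]) ⟩
      lampAt s i xor does (i ℤ.≟ -[1+ 0 ] ℤ.+ m₊₁)
        ≡⟨ cong (λ j → lampAt s i xor does (i ℤ.≟ j)) down-up ⟩
      lampAt s i xor does (i ℤ.≟ m)
        ≡⟨ lampAt-toggle s m i ⟨
      lampAt (toggle s m) i ∎)
    (trans (ℤ.+-comm m₊₁ -[1+ 0 ]) down-up))
  where
  open ≡-Reasoning
  m₊₁ = m ℤ.+ + 1
  down-up : -[1+ 0 ] ℤ.+ m₊₁ ≡ m
  down-up = trans (ℤ.+-comm -[1+ 0 ] m₊₁) (plus-minus m (+ 1))

toggle-bits : ∀ v c w k →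
  at (norm (v ++ c ∷ w)) k xor does (+ k ℤ.≟ + length v) ≡ at (norm (v ++ not c ∷ w)) k
toggle-bits []      c w zero
  rewrite at-norm-head c w | at-norm-head (not c) w = trans (xor-comm c true) (true-xor c)
toggle-bits []      c w (suc k)
  rewrite at-norm-tail c w k | at-norm-tail (not c) w k = xor-identityʳ _
toggle-bits (x ∷ v) c w zero
  rewrite at-norm-head x (v ++ c ∷ w) | at-norm-head x (v ++ not c ∷ w) = xor-identityʳ x
toggle-bits (x ∷ v) c w (suc k)
  rewrite at-norm-tail x (v ++ c ∷ w) k | at-norm-tail x (v ++ not c ∷ w) k = toggle-bits v c w k

toggle-at-length : ∀ v c w l →
  toggle (lamps (norm (v ++ c ∷ w)) l) (+ length v) ≡ lamps (norm (v ++ not c ∷ w)) l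
toggle-at-length v c w l = lampAt-injective _ _ bits
  where
  bits : ∀ i → lampAt (toggle (lamps (norm (v ++ c ∷ w)) l) (+ length v)) i
             ≡ lampAt (lamps (norm (v ++ not c ∷ w)) l) i
  bits (+ k)    = trans (lampAt-toggle (lamps (norm (v ++ c ∷ w)) l) (+ length v) (+ k))
                        (toggle-bits v c w k)
  bits -[1+ k ] = trans (lampAt-toggle (lamps (norm (v ++ c ∷ w)) l) (+ length v) -[1+ k ])
                        (xor-identityʳ _)

-- The fourteen solutions (η_g, η_{gab⁻¹}, η_{ga}, η_{gb}) of the local rule.
data Tile : A → A → A → A → Set where
  sea-sea-nw-ne       : Tile sea sea nw ne
  sea-sea-ne-nw       : Tile sea sea ne nw
  up-up-up-up         : Tile up up up up
  nw-nw-up-nw         : Tile nw nw up nw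
  nw-nw-nw-up         : Tile nw nw nw up
  ne-ne-up-ne         : Tile ne ne up ne
  ne-ne-ne-up         : Tile ne ne ne up
  down-down-down-down : Tile down down down down
  down-sw-sw-sw       : Tile down sw sw sw
  sw-down-sw-sw       : Tile sw down sw sw
  down-se-se-se       : Tile down se se se
  se-down-se-se       : Tile se down se se
  sw-se-sea-sea       : Tile sw se sea sea
  se-sw-sea-sea       : Tile se sw sea sea

φ≡0⇒sea : ∀ x → + 0 ≡ φ x → x ≡ sea
φ≡0⇒sea sea _ = refl
φ≡0⇒sea nw   ()
φ≡0⇒sea up   ()
φ≡0⇒sea ne   ()
φ≡0⇒sea sw   ()
φ≡0⇒sea down ()
φ≡0⇒sea se   ()

no-double-climb : ¬ (+ 2 ≡ + 0 ⊎ + 2 ≡ + 1)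
no-double-climb (inj₁ ())
no-double-climb (inj₂ ())

tile-of-rule : ∀ α β γ δ → LocalRule α β γ δ → Tile α β γ δ
tile-of-rule α β sea δ ((_ , φγ≡φδ) , _ , _ , seaγ , _) with seaγ refl | φ≡0⇒sea δ φγ≡φδ
... | inj₁ (refl , refl) | refl = sw-se-sea-sea
... | inj₂ (refl , refl) | refl = se-sw-sea-sea
tile-of-rule α β sw δ (_ , _ , _ , _ , _ , downγ) with downγ (inj₁ refl)
... | refl , inj₁ (refl , refl) = down-sw-sw-sw
... | refl , inj₂ (refl , refl) = sw-down-sw-sw
tile-of-rule α β down δ (_ , _ , _ , _ , _ , downγ) with downγ (inj₂ (inj₁ refl))
... | refl , inj₁ (refl , refl) = down-down-down-down
... | refl , inj₂ (refl , refl) = down-down-down-down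
tile-of-rule α β se δ (_ , _ , _ , _ , _ , downγ) with downγ (inj₂ (inj₂ refl))
... | refl , inj₁ (refl , refl) = down-se-se-se
... | refl , inj₂ (refl , refl) = se-down-se-se
tile-of-rule sea β γ δ ((φα≡φβ , _) , _ , seaα , _) with seaα refl | φ≡0⇒sea β φα≡φβ
... | inj₁ (refl , refl) | refl = sea-sea-nw-ne
... | inj₂ (refl , refl) | refl = sea-sea-ne-nw
tile-of-rule nw β γ δ (_ , _ , _ , _ , upα , _) with upα (inj₁ refl)
... | refl , inj₁ (refl , refl) = nw-nw-up-nw
... | refl , inj₂ (refl , refl) = nw-nw-nw-up
tile-of-rule up β γ δ (_ , _ , _ , _ , upα , _) with upα (inj₂ (inj₁ refl))
... | refl , inj₁ (refl , refl) = up-up-up-up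
... | refl , inj₂ (refl , refl) = up-up-up-up
tile-of-rule ne β γ δ (_ , _ , _ , _ , upα , _) with upα (inj₂ (inj₂ refl))
... | refl , inj₁ (refl , refl) = ne-ne-up-ne
... | refl , inj₂ (refl , refl) = ne-ne-ne-up
tile-of-rule sw   _ nw _ (_ , climb , _) = ⊥-elim (no-double-climb climb)
tile-of-rule sw   _ up _ (_ , climb , _) = ⊥-elim (no-double-climb climb)
tile-of-rule sw   _ ne _ (_ , climb , _) = ⊥-elim (no-double-climb climb)
tile-of-rule down _ nw _ (_ , climb , _) = ⊥-elim (no-double-climb climb)
tile-of-rule down _ up _ (_ , climb , _) = ⊥-elim (no-double-climb climb)
tile-of-rule down _ ne _ (_ , climb , _) = ⊥-elim (no-double-climb climb)
tile-of-rule se   _ nw _ (_ , climb , _) = ⊥-elim (no-double-climb climb)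
tile-of-rule se   _ up _ (_ , climb , _) = ⊥-elim (no-double-climb climb)
tile-of-rule se   _ ne _ (_ , climb , _) = ⊥-elim (no-double-climb climb)

module _ {α β γ δ : A} where

  tile-levels : Tile α β γ δ →
    (φ α ≡ φ β × φ γ ≡ φ δ) × (φ γ ℤ.- φ α ≡ + 0 ⊎ φ γ ℤ.- φ α ≡ + 1)
  tile-levels sea-sea-nw-ne       = (refl , refl) , inj₂ refl
  tile-levels sea-sea-ne-nw       = (refl , refl) , inj₂ refl
  tile-levels up-up-up-up         = (refl , refl) , inj₁ refl
  tile-levels nw-nw-up-nw         = (refl , refl) , inj₁ refl
  tile-levels nw-nw-nw-up         = (refl , refl) , inj₁ refl
  tile-levels ne-ne-up-ne         = (refl , refl) , inj₁ refl
  tile-levels ne-ne-ne-up         = (refl , refl) , inj₁ refl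
  tile-levels down-down-down-down = (refl , refl) , inj₁ refl
  tile-levels down-sw-sw-sw       = (refl , refl) , inj₁ refl
  tile-levels sw-down-sw-sw       = (refl , refl) , inj₁ refl
  tile-levels down-se-se-se       = (refl , refl) , inj₁ refl
  tile-levels se-down-se-se       = (refl , refl) , inj₁ refl
  tile-levels sw-se-sea-sea       = (refl , refl) , inj₂ refl
  tile-levels se-sw-sea-sea       = (refl , refl) , inj₂ refl

  tile-sea-bottom : Tile α β γ δ → α ≡ sea → PairEq γ δ nw ne
  tile-sea-bottom sea-sea-nw-ne refl = inj₁ (refl , refl)
  tile-sea-bottom sea-sea-ne-nw refl = inj₂ (refl , refl)

  tile-sea-top : Tile α β γ δ → γ ≡ sea → PairEq α β sw se
  tile-sea-top sw-se-sea-sea refl = inj₁ (refl , refl)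
  tile-sea-top se-sw-sea-sea refl = inj₂ (refl , refl)

  tile-upper : Tile α β γ δ → InU α → β ≡ α × PairEq γ δ up α
  tile-upper up-up-up-up (inj₂ (inj₁ refl))        = refl , inj₁ (refl , refl)
  tile-upper nw-nw-up-nw (inj₁ refl)               = refl , inj₁ (refl , refl)
  tile-upper nw-nw-nw-up (inj₁ refl)               = refl , inj₂ (refl , refl)
  tile-upper ne-ne-up-ne (inj₂ (inj₂ refl))        = refl , inj₁ (refl , refl)
  tile-upper ne-ne-ne-up (inj₂ (inj₂ refl))        = refl , inj₂ (refl , refl)

  tile-lower : Tile α β γ δ → InD γ → δ ≡ γ × PairEq α β down γ
  tile-lower down-down-down-down (inj₂ (inj₁ refl)) = refl , inj₁ (refl , refl)
  tile-lower down-sw-sw-sw       (inj₁ refl)        = refl , inj₁ (refl , refl)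
  tile-lower sw-down-sw-sw       (inj₁ refl)        = refl , inj₂ (refl , refl)
  tile-lower down-se-se-se       (inj₂ (inj₂ refl)) = refl , inj₁ (refl , refl)
  tile-lower se-down-se-se       (inj₂ (inj₂ refl)) = refl , inj₂ (refl , refl)

  rule-of-tile : Tile α β γ δ → LocalRule α β γ δ
  rule-of-tile t = proj₁ (tile-levels t) , proj₂ (tile-levels t) ,
    tile-sea-bottom t , tile-sea-top t , tile-upper t , tile-lower t

AtOrAboveSea : A → Set
AtOrAboveSea x = x ≡ sea ⊎ InU x

Diagonal : A → Set
Diagonal X = X ≡ nw ⊎ X ≡ ne

module _ {α β γ δ : A} where

  tile-above-sea : AtOrAboveSea α → Tile α β γ δ → β ≡ α × InU γ × InU δ
  tile-above-sea (inj₁ refl)        sea-sea-nw-ne = refl , inj₁ refl , inj₂ (inj₂ refl)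
  tile-above-sea (inj₁ refl)        sea-sea-ne-nw = refl , inj₂ (inj₂ refl) , inj₁ refl
  tile-above-sea (inj₂ (inj₁ refl)) nw-nw-up-nw   = refl , inj₂ (inj₁ refl) , inj₁ refl
  tile-above-sea (inj₂ (inj₁ refl)) nw-nw-nw-up   = refl , inj₁ refl , inj₂ (inj₁ refl)
  tile-above-sea (inj₂ (inj₂ (inj₁ refl))) up-up-up-up = refl , inj₂ (inj₁ refl) , inj₂ (inj₁ refl)
  tile-above-sea (inj₂ (inj₂ (inj₂ refl))) ne-ne-up-ne = refl , inj₂ (inj₁ refl) , inj₂ (inj₂ refl)
  tile-above-sea (inj₂ (inj₂ (inj₂ refl))) ne-ne-ne-up = refl , inj₂ (inj₂ refl) , inj₂ (inj₁ refl)

  tile-diagonal-child : ∀ {X} → Diagonal X → α ≡ sea ⊎ α ≡ X → Tile α β γ δ → γ ≡ X ⊎ δ ≡ X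
  tile-diagonal-child (inj₁ refl) (inj₁ refl) sea-sea-nw-ne = inj₁ refl
  tile-diagonal-child (inj₁ refl) (inj₁ refl) sea-sea-ne-nw = inj₂ refl
  tile-diagonal-child (inj₁ refl) (inj₂ refl) nw-nw-up-nw   = inj₂ refl
  tile-diagonal-child (inj₁ refl) (inj₂ refl) nw-nw-nw-up   = inj₁ refl
  tile-diagonal-child (inj₂ refl) (inj₁ refl) sea-sea-nw-ne = inj₂ refl
  tile-diagonal-child (inj₂ refl) (inj₁ refl) sea-sea-ne-nw = inj₁ refl
  tile-diagonal-child (inj₂ refl) (inj₂ refl) ne-ne-up-ne   = inj₂ refl
  tile-diagonal-child (inj₂ refl) (inj₂ refl) ne-ne-ne-up   = inj₁ refl

  tile-diagonal-parent : ∀ {X} → Diagonal X → γ ≡ X ⊎ δ ≡ X → Tile α β γ δ → α ≡ sea ⊎ α ≡ X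
  tile-diagonal-parent (inj₁ refl) (inj₁ refl) sea-sea-nw-ne = inj₁ refl
  tile-diagonal-parent (inj₁ refl) (inj₁ refl) nw-nw-nw-up   = inj₂ refl
  tile-diagonal-parent (inj₁ refl) (inj₂ refl) sea-sea-ne-nw = inj₁ refl
  tile-diagonal-parent (inj₁ refl) (inj₂ refl) nw-nw-up-nw   = inj₂ refl
  tile-diagonal-parent (inj₂ refl) (inj₁ refl) sea-sea-ne-nw = inj₁ refl
  tile-diagonal-parent (inj₂ refl) (inj₁ refl) ne-ne-ne-up   = inj₂ refl
  tile-diagonal-parent (inj₂ refl) (inj₂ refl) sea-sea-nw-ne = inj₁ refl
  tile-diagonal-parent (inj₂ refl) (inj₂ refl) ne-ne-up-ne   = inj₂ refl

  tile-diagonal-once : ∀ {X} → Diagonal X → γ ≡ X → δ ≡ X → ¬ Tile α β γ δ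
  tile-diagonal-once (inj₁ refl) refl refl ()
  tile-diagonal-once (inj₂ refl) refl refl ()

tile-bottom-unique : ∀ {α β α′ β′ γ δ γ′ δ′} → InU γ → γ′ ≡ γ → δ′ ≡ δ →
                     Tile α β γ δ → Tile α′ β′ γ′ δ′ → α ≡ α′
tile-bottom-unique (inj₁ refl)        refl refl sea-sea-nw-ne sea-sea-nw-ne = refl
tile-bottom-unique (inj₁ refl)        refl refl nw-nw-nw-up   nw-nw-nw-up   = refl
tile-bottom-unique (inj₂ (inj₁ refl)) refl refl up-up-up-up   up-up-up-up   = refl
tile-bottom-unique (inj₂ (inj₁ refl)) refl refl nw-nw-up-nw   nw-nw-up-nw   = refl
tile-bottom-unique (inj₂ (inj₁ refl)) refl refl ne-ne-up-ne   ne-ne-up-ne   = refl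
tile-bottom-unique (inj₂ (inj₂ refl)) refl refl sea-sea-ne-nw sea-sea-ne-nw = refl
tile-bottom-unique (inj₂ (inj₂ refl)) refl refl ne-ne-ne-up   ne-ne-ne-up   = refl

upper-symbol : ∀ {x} → InU x → x ≢ nw → x ≢ ne → x ≡ up
upper-symbol (inj₁ refl)        x≢nw _    = ⊥-elim (x≢nw refl)
upper-symbol (inj₂ (inj₁ refl)) _    _    = refl
upper-symbol (inj₂ (inj₂ refl)) _    x≢ne = ⊥-elim (x≢ne refl)

upsideDown : A → A
upsideDown nw   = sw
upsideDown up   = down
upsideDown ne   = se
upsideDown sea  = sea
upsideDown sw   = nw
upsideDown down = up
upsideDown se   = ne

upsideDown-involutive : ∀ x → upsideDown (upsideDown x) ≡ x
upsideDown-involutive nw   = refl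
upsideDown-involutive up   = refl
upsideDown-involutive ne   = refl
upsideDown-involutive sea  = refl
upsideDown-involutive sw   = refl
upsideDown-involutive down = refl
upsideDown-involutive se   = refl

tile-upsideDown : ∀ {α β γ δ} → Tile α β γ δ →
                  Tile (upsideDown γ) (upsideDown δ) (upsideDown α) (upsideDown β)
tile-upsideDown sea-sea-nw-ne       = sw-se-sea-sea
tile-upsideDown sea-sea-ne-nw       = se-sw-sea-sea
tile-upsideDown up-up-up-up         = down-down-down-down
tile-upsideDown nw-nw-up-nw         = down-sw-sw-sw
tile-upsideDown nw-nw-nw-up         = sw-down-sw-sw
tile-upsideDown ne-ne-up-ne         = down-se-se-se
tile-upsideDown ne-ne-ne-up         = se-down-se-se
tile-upsideDown down-down-down-down = up-up-up-up
tile-upsideDown down-sw-sw-sw       = nw-nw-up-nw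
tile-upsideDown sw-down-sw-sw       = nw-nw-nw-up
tile-upsideDown down-se-se-se       = ne-ne-up-ne
tile-upsideDown se-down-se-se       = ne-ne-ne-up
tile-upsideDown sw-se-sea-sea       = sea-sea-nw-ne
tile-upsideDown se-sw-sea-sea       = sea-sea-ne-nw

Tile-≡ : ∀ {α β γ δ α′ β′ γ′ δ′} → α ≡ α′ → β ≡ β′ → γ ≡ γ′ → δ ≡ δ′ →
         Tile α β γ δ ≡ Tile α′ β′ γ′ δ′
Tile-≡ refl refl refl refl = refl

Cell : Config → L → Set
Cell η g = Tile (η g) (η ((g · a) · inv b)) (η (g · a)) (η (g · b))

InΩ⇔cells : ∀ η → InΩ η ⇔ (∀ g → Cell η g)
InΩ⇔cells η = mk⇔ (λ Ω g → tile-of-rule _ _ _ _ (Ω g)) (λ cells g → rule-of-tile (cells g))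

cell-cong : ∀ {η η′} → (∀ g → η g ≡ η′ g) → ∀ g → Cell η g → Cell η′ g
cell-cong eq g = subst (λ T → T) (Tile-≡ (eq g) (eq _) (eq _) (eq _))

applyUpTo-++ : ∀ (f : ℕ → Bool) n m →
               applyUpTo f n ++ applyUpTo (λ j → f (n ℕ.+ j)) m ≡ applyUpTo f (n ℕ.+ m)
applyUpTo-++ f zero    m = refl
applyUpTo-++ f (suc n) m = cong (f 0 ∷_) (applyUpTo-++ (f ∘ suc) n m)

U-coordinates : ∀ s n → ∃[ u ] ∃[ v ] ∃[ c ] ∃[ w ] ⟨ s , + n ⟩ ≡ U u v (c ∷ w)
U-coordinates (lamps r l) n =
  reverse left-bits , applyUpTo (at r) n , at r (n ℕ.+ 0) ,
  applyUpTo (λ j → at r (n ℕ.+ suc j)) (size r) ,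
  cong₂ ⟨_,_⟩ (cong₂ lamps (sym right-eq) (sym left-eq))
              (cong +_ (sym (List.length-applyUpTo (at r) n)))
  where
  left-bits = applyUpTo (at l) (size l)
  right-eq : norm (applyUpTo (at r) n ++ applyUpTo (λ j → at r (n ℕ.+ j)) (suc (size r))) ≡ r
  right-eq = trans (cong norm (applyUpTo-++ (at r) n (suc (size r))))
                   (norm-applyUpTo-at r (n ℕ.+ suc (size r)) (ℕ.≤-trans (ℕ.n≤1+n _) (ℕ.m≤n+m _ n)))
  left-eq : norm (reverse (reverse left-bits)) ≡ l
  left-eq = trans (cong norm (List.reverse-involutive left-bits)) (norm-applyUpTo-at l (size l) ℕ.≤-refl)

module _ (u v : List Bool) (c : Bool) (w : List Bool) where

  private
    s₀ = lamps (norm (v ++ c ∷ w)) (norm (reverse u))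
    U-shift : ∀ c → ⟨ lamps (norm (v ++ c ∷ w)) (norm (reverse u)) , + length v ℤ.+ + 1 ⟩
                    ≡ U u (v ∷ʳ c) w
    U-shift c = cong₂ (λ xs n → ⟨ lamps (norm xs) (norm (reverse u)) , + n ⟩)
                      (sym (List.++-assoc v (c ∷ []) w)) (sym (List.length-++ v))

  U-·a : U u v (c ∷ w) · a ≡ U u (v ∷ʳ c) w
  U-·a = trans (·a s₀ (+ length v)) (U-shift c)

  U-·a·b⁻¹ : (U u v (c ∷ w) · a) · inv b ≡ U u v (not c ∷ w)
  U-·a·b⁻¹ = trans (·a·b⁻¹ s₀ (+ length v))
                   (cong ⟨_, + length v ⟩ (toggle-at-length v c w (norm (reverse u))))

  U-·b : U u v (c ∷ w) · b ≡ U u (v ∷ʳ not c) w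
  U-·b = trans (cong ⟨_, + length v ℤ.+ + 1 ⟩ (toggle-at-length v c w (norm (reverse u)))) (U-shift (not c))

  cell-U : ∀ η → Cell η (U u v (c ∷ w))
                 ≡ Tile (η (U u v (c ∷ w))) (η (U u v (not c ∷ w)))
                        (η (U u (v ∷ʳ c) w)) (η (U u (v ∷ʳ not c) w))
  cell-U η = Tile-≡ refl (cong η U-·a·b⁻¹) (cong η U-·a) (cong η U-·b)

-- The reflection symmetry

mirrorLamps : Lamps → Lamps
mirrorLamps (lamps r l) = lamps l r

-- index of the lamp at -(i + 1/2), the mirror image of the lamp at i + 1/2
mirrorIndex : ℤ → ℤ
mirrorIndex (+ k)    = -[1+ k ]
mirrorIndex -[1+ k ] = + k

mirror : L → L
mirror ⟨ s , n ⟩ = ⟨ mirrorLamps s , ℤ.- n ⟩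

dual : Config → Config
dual η g = upsideDown (η (mirror g))

mirror-involutive : ∀ g → mirror (mirror g) ≡ g
mirror-involutive ⟨ lamps r l , n ⟩ = cong ⟨ lamps r l ,_⟩ (ℤ.neg-involutive n)

dual-involutive : ∀ η g → dual (dual η) g ≡ η g
dual-involutive η g = trans (upsideDown-involutive _) (cong η (mirror-involutive g))

mirrorIndex-≡ : ∀ n → mirrorIndex n ≡ ℤ.- (n ℤ.+ + 1)
mirrorIndex-≡ (+ k)          = cong (λ j → ℤ.- (+ j)) (ℕ.+-comm 1 k)
mirrorIndex-≡ -[1+ zero ]    = refl
mirrorIndex-≡ -[1+ suc k ]   = refl

mirrorIndex-+1 : ∀ n → mirrorIndex n ℤ.+ + 1 ≡ ℤ.- n
mirrorIndex-+1 (+ zero)  = refl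
mirrorIndex-+1 (+ suc k) = refl
mirrorIndex-+1 -[1+ k ]  = cong +_ (ℕ.+-comm k 1)

toggle-mirror : ∀ s m → mirrorLamps (toggle s m) ≡ toggle (mirrorLamps s) (mirrorIndex m)
toggle-mirror s m = lampAt-injective _ _ λ i → begin
  lampAt (mirrorLamps (toggle s m)) i
    ≡⟨ lampAt-mirror (toggle s m) i ⟩
  lampAt (toggle s m) (mirrorIndex i)
    ≡⟨ lampAt-toggle s m (mirrorIndex i) ⟩
  lampAt s (mirrorIndex i) xor does (mirrorIndex i ℤ.≟ m)
    ≡⟨ cong₂ _xor_ (sym (lampAt-mirror s i)) (does-mirror i m) ⟩
  lampAt (mirrorLamps s) i xor does (i ℤ.≟ mirrorIndex m)
    ≡⟨ lampAt-toggle (mirrorLamps s) (mirrorIndex m) i ⟨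
  lampAt (toggle (mirrorLamps s) (mirrorIndex m)) i ∎
  where
  open ≡-Reasoning
  lampAt-mirror : ∀ t i → lampAt (mirrorLamps t) i ≡ lampAt t (mirrorIndex i)
  lampAt-mirror (lamps r l) (+ k)    = refl
  lampAt-mirror (lamps r l) -[1+ k ] = refl
  does-mirror : ∀ i m → does (mirrorIndex i ℤ.≟ m) ≡ does (i ℤ.≟ mirrorIndex m)
  does-mirror (+ k)    (+ j)    = refl
  does-mirror (+ k)    -[1+ j ] = refl
  does-mirror -[1+ k ] (+ j)    = refl
  does-mirror -[1+ k ] -[1+ j ] = refl

-- The mirror image of the cell at g is the cell at mirror (g · a), turned upside down.
cell-dual : ∀ η s n → Cell η ⟨ mirrorLamps s , mirrorIndex n ⟩ → Cell (dual η) ⟨ s , n ⟩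
cell-dual η s n cell = subst (λ T → T) (Tile-≡ (cong ud-η raised) (cong ud-η raised-flipped)
                                                (cong ud-η (sym here)) (cong ud-η flipped))
                                        (tile-upsideDown cell)
  where
  ud-η = upsideDown ∘ η
  h = ⟨ mirrorLamps s , mirrorIndex n ⟩
  here : mirror (⟨ s , n ⟩ · a) ≡ h
  here = trans (cong mirror (·a s n)) (cong ⟨ mirrorLamps s ,_⟩ (sym (mirrorIndex-≡ n)))
  raised : h · a ≡ mirror ⟨ s , n ⟩
  raised = trans (·a (mirrorLamps s) (mirrorIndex n)) (cong ⟨ mirrorLamps s ,_⟩ (mirrorIndex-+1 n))
  flipped : (h · a) · inv b ≡ mirror (⟨ s , n ⟩ · b)
  flipped = trans (·a·b⁻¹ (mirrorLamps s) (mirrorIndex n))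
                  (cong₂ ⟨_,_⟩ (sym (toggle-mirror s n)) (mirrorIndex-≡ n))
  raised-flipped : h · b ≡ mirror ((⟨ s , n ⟩ · a) · inv b)
  raised-flipped = trans (cong₂ ⟨_,_⟩ (sym (toggle-mirror s n)) (mirrorIndex-+1 n))
                     (sym (cong mirror (·a·b⁻¹ s n)))

InΩ-dual : ∀ η → InΩ η → InΩ (dual η)
InΩ-dual η Ω = Equivalence.from (InΩ⇔cells (dual η)) λ where
  ⟨ s , n ⟩ → cell-dual η s n (Equivalence.to (InΩ⇔cells η) Ω _)

mirror-U : ∀ u v w → mirror (U u v w) ≡ D (reverse w) (reverse v) (reverse u)
mirror-U u v w = cong₂ (λ xs n → ⟨ lamps (norm (reverse u)) (norm xs) , ℤ.- (+ n) ⟩)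
  (sym (trans (List.reverse-++ (reverse w) (reverse v))
              (cong₂ _++_ (List.reverse-involutive v) (List.reverse-involutive w))))
  (sym (List.length-reverse v))

mirror-D : ∀ w v u → mirror (D w v u) ≡ U (reverse u) (reverse v) (reverse w)
mirror-D w v u = cong₂ ⟨_,_⟩
  (cong₂ lamps (cong norm (List.reverse-++ w v)) (cong norm (sym (List.reverse-involutive u))))
  (trans (ℤ.neg-involutive _) (cong +_ (sym (List.length-reverse v))))

mirror-C : ∀ u v → mirror (C u v) ≡ C (reverse v) (reverse u)
mirror-C u v = cong (λ xs → ⟨ lamps (norm (reverse u)) (norm xs) , + 0 ⟩)
                    (sym (List.reverse-involutive v))

Prefix-∷ : ∀ x v s → Prefix (x ∷ v) s ⇔ (x ≡ s 0 × Prefix v (s ∘ suc))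
Prefix-∷ x v s = mk⇔ (λ P → P Fin.zero , P ∘ Fin.suc) from
  where
  from : x ≡ s 0 × Prefix v (s ∘ suc) → Prefix (x ∷ v) s
  from (x≡ , P) Fin.zero    = x≡
  from (x≡ , P) (Fin.suc i) = P i

Prefix-∷ʳ : ∀ v c s → Prefix (v ∷ʳ c) s ⇔ (Prefix v s × c ≡ s (length v))
Prefix-∷ʳ [] c s = mk⇔ (λ P → (λ ()) , P Fin.zero) λ where (_ , c≡) Fin.zero → c≡
Prefix-∷ʳ (x ∷ v) c s = mk⇔
  (λ P → let x≡ , P′ = Equivalence.to (Prefix-∷ x (v ∷ʳ c) s) P
             Pv , c≡ = Equivalence.to (Prefix-∷ʳ v c (s ∘ suc)) P′
         in Equivalence.from (Prefix-∷ x v s) (x≡ , Pv) , c≡)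
  (λ (P , c≡) → let x≡ , Pv = Equivalence.to (Prefix-∷ x v s) P
                in Equivalence.from (Prefix-∷ x (v ∷ʳ c) s)
                     (x≡ , Equivalence.from (Prefix-∷ʳ v c (s ∘ suc)) (Pv , c≡)))

Prefix? : ∀ v s → Dec (Prefix v s)
Prefix? []      s = yes λ ()
Prefix? (x ∷ v) s = map′ (Equivalence.from (Prefix-∷ x v s)) (Equivalence.to (Prefix-∷ x v s))
                          (x ≟ᵇ s 0 ×-dec Prefix? v (s ∘ suc))

prefix-heads : ∀ v p q → 0 < length v → Prefix v p → Prefix v q → p 0 ≡ q 0
prefix-heads (x ∷ v) p q _ P Q = trans (sym (P Fin.zero)) (Q Fin.zero)

-- Binary trees of tiles rooted at sea level

code : A → ℕ
code nw = 0
code up = 1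
code ne = 2
code sea = 3
code sw = 4
code down = 5
code se = 6

decode : ℕ → A
decode 0 = nw
decode 1 = up
decode 2 = ne
decode 3 = sea
decode 4 = sw
decode 5 = down
decode _ = se

decode-code : ∀ x → decode (code x) ≡ x
decode-code nw   = refl
decode-code up   = refl
decode-code ne   = refl
decode-code sea  = refl
decode-code sw   = refl
decode-code down = refl
decode-code se   = refl

infix 4 _≟ᴬ_
opaque
  _≟ᴬ_ : DecidableEquality A
  x ≟ᴬ y = map′ (λ eq → trans (sym (decode-code x)) (trans (cong decode eq) (decode-code y)))
                (cong code) (code x ℕ.≟ code y)

diagonal-tests-differ : ∀ {x} → Diagonal x → does (x ≟ᴬ nw) ≢ does (x ≟ᴬ ne)
diagonal-tests-differ (inj₁ refl) eq
  with () ← trans (sym (dec-true (nw ≟ᴬ nw) refl)) (trans eq (dec-false (nw ≟ᴬ ne) λ ()))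
diagonal-tests-differ (inj₂ refl) eq
  with () ← trans (sym (dec-false (ne ≟ᴬ nw) λ ())) (trans eq (dec-true (ne ≟ᴬ ne) refl))

TreeRules : (List Bool → A) → (ℕ → Bool) → (ℕ → Bool) → Set
TreeRules F p q =
    (∀ v → 0 < length v → Prefix v p → F v ≡ nw)
  × (∀ v → 0 < length v → Prefix v q → F v ≡ ne)
  × (∀ v → 0 < length v → ¬ Prefix v p → ¬ Prefix v q → F v ≡ up)

pick : ∀ {P : Bool → Set} c → P false → P true → P c
pick false f t = f
pick true  f t = t

sea∉U : ¬ InU sea
sea∉U (inj₁ ())
sea∉U (inj₂ (inj₁ ()))
sea∉U (inj₂ (inj₂ ()))

length-∷ʳ : ∀ (v : List Bool) c → length (v ∷ʳ c) ≡ suc (length v)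
length-∷ʳ v c = trans (List.length-++ v) (ℕ.+-comm (length v) 1)

module SeaRootedTree (F : List Bool → A) (root : F [] ≡ sea)
  (node : ∀ v → ∃[ β ] Tile (F v) β (F (v ∷ʳ false)) (F (v ∷ʳ true))) where

  above-sea : ∀ {v} → Reverse v → AtOrAboveSea (F v)
  child-upper : ∀ {v} → Reverse v → ∀ c → InU (F (v ∷ʳ c))

  above-sea []              = inj₁ root
  above-sea (_ ∶ rs ∶ʳ c)   = inj₂ (child-upper rs c)

  child-upper {v} rs c = let _ , tops = tile-above-sea (above-sea rs) (proj₂ (node v))
                         in pick {λ c → InU (F (v ∷ʳ c))} c (proj₁ tops) (proj₂ tops)

  nonempty-upper : ∀ v → 0 < length v → InU (F v)
  nonempty-upper v 0<∣v∣ with reverseView v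
  ... | [] with () ← 0<∣v∣
  ... | xs ∶ rs ∶ʳ c = child-upper rs c

  -- The nodes carrying a given diagonal arrow X form a single infinite ray.
  module Ray (X : A) (diag : Diagonal X) where

    choice : List Bool → Bool
    choice v = does (F (v ∷ʳ true) ≟ᴬ X)

    ray : ℕ → List Bool
    ray zero    = []
    ray (suc k) = ray k ∷ʳ choice (ray k)

    word : ℕ → Bool
    word k = choice (ray k)

    choice-leads-to-X : ∀ v → F v ≡ sea ⊎ F v ≡ X → F (v ∷ʳ choice v) ≡ X
    choice-leads-to-X v below with F (v ∷ʳ true) ≟ᴬ X
    ... | yes right≡X = right≡X
    ... | no  right≢X with tile-diagonal-child diag below (proj₂ (node v))
    ...   | inj₁ left≡X  = left≡X
    ...   | inj₂ right≡X = ⊥-elim (right≢X right≡X)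

    only-choice-leads-to-X : ∀ v c → F (v ∷ʳ c) ≡ X → c ≡ choice v
    only-choice-leads-to-X v c child≡X with F (v ∷ʳ true) ≟ᴬ X
    only-choice-leads-to-X v true  child≡X | yes _ = refl
    only-choice-leads-to-X v false child≡X | yes right≡X =
      ⊥-elim (tile-diagonal-once diag child≡X right≡X (proj₂ (node v)))
    only-choice-leads-to-X v true  child≡X | no right≢X = ⊥-elim (right≢X child≡X)
    only-choice-leads-to-X v false child≡X | no _ = refl

    prefix⇒ray : ∀ {v} → Reverse v → Prefix v word → v ≡ ray (length v)
    prefix⇒ray []               _ = refl
    prefix⇒ray (xs ∶ rs ∶ʳ c)   P =
      let Pxs , c≡ = Equivalence.to (Prefix-∷ʳ xs c word) P
          xs≡ = prefix⇒ray rs Pxs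
      in begin
        xs ∷ʳ c                                   ≡⟨ cong₂ _∷ʳ_ xs≡ c≡ ⟩
        ray (length xs) ∷ʳ choice (ray (length xs)) ≡⟨ cong ray (sym (length-∷ʳ xs c)) ⟩
        ray (length (xs ∷ʳ c))                    ∎
      where open ≡-Reasoning

    prefix⇒X : ∀ {v} → Reverse v → Prefix v word → F v ≡ sea ⊎ F v ≡ X
    prefix⇒X []             _ = inj₁ root
    prefix⇒X (xs ∶ rs ∶ʳ c) P =
      let Pxs , c≡ = Equivalence.to (Prefix-∷ʳ xs c word) P
          c≡choice = trans c≡ (cong choice (sym (prefix⇒ray rs Pxs)))
      in inj₂ (subst (λ c → F (xs ∷ʳ c) ≡ X) (sym c≡choice)
                     (choice-leads-to-X xs (prefix⇒X rs Pxs)))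

    X⇒prefix : ∀ {v} → Reverse v → F v ≡ sea ⊎ F v ≡ X → Prefix v word
    X⇒prefix []             _            = λ ()
    X⇒prefix (xs ∶ rs ∶ʳ c) (inj₁ F≡sea) = ⊥-elim (sea∉U (subst InU F≡sea (child-upper rs c)))
    X⇒prefix (xs ∶ rs ∶ʳ c) (inj₂ F≡X)   =
      let parent = tile-diagonal-parent diag
                     (pick {λ c → F (xs ∷ʳ c) ≡ X → F (xs ∷ʳ false) ≡ X ⊎ F (xs ∷ʳ true) ≡ X}
                           c inj₁ inj₂ F≡X)
                     (proj₂ (node xs))
          Pxs = X⇒prefix rs parent
          c≡word = trans (only-choice-leads-to-X xs c F≡X) (cong choice (prefix⇒ray rs Pxs))
      in Equivalence.from (Prefix-∷ʳ xs c word) (Pxs , c≡word)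

    nonempty-prefix⇒X : ∀ v → 0 < length v → Prefix v word → F v ≡ X
    nonempty-prefix⇒X v 0<∣v∣ P with prefix⇒X (reverseView v) P
    ... | inj₁ F≡sea = ⊥-elim (sea∉U (subst InU F≡sea (nonempty-upper v 0<∣v∣)))
    ... | inj₂ F≡X   = F≡X

  module NW = Ray nw (inj₁ refl)
  module NE = Ray ne (inj₂ refl)

  tree-rules : ∃[ p ] ∃[ q ] p 0 ≢ q 0 × TreeRules F p q
  tree-rules = NW.word , NE.word , heads-differ ,
               NW.nonempty-prefix⇒X , NE.nonempty-prefix⇒X , upper
    where
    heads-differ : NW.word 0 ≢ NE.word 0
    heads-differ with tile-sea-bottom (proj₂ (node [])) root
    ... | inj₁ (_ , right≡ne) = diagonal-tests-differ (inj₂ right≡ne)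
    ... | inj₂ (_ , right≡nw) = diagonal-tests-differ (inj₁ right≡nw)
    upper : ∀ v → 0 < length v → ¬ Prefix v NW.word → ¬ Prefix v NE.word → F v ≡ up
    upper v 0<∣v∣ ¬P ¬Q = upper-symbol (nonempty-upper v 0<∣v∣)
      (λ F≡nw → ¬P (NW.X⇒prefix (reverseView v) (inj₂ F≡nw)))
      (λ F≡ne → ¬Q (NE.X⇒prefix (reverseView v) (inj₂ F≡ne)))

-- Configurations in Ω with sea at the identity

UpperRules : Config → List Bool → (ℕ → Bool) → (ℕ → Bool) → Set
UpperRules η u p q =
    (∀ v w → 0 < length v → Prefix v p → η (U u v w) ≡ nw)
  × (∀ v w → 0 < length v → Prefix v q → η (U u v w) ≡ ne)
  × (∀ v w → 0 < length v → ¬ Prefix v p → ¬ Prefix v q → η (U u v w) ≡ up)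

LowerRules : Config → List Bool → (ℕ → Bool) → (ℕ → Bool) → Set
LowerRules η u p q =
    (∀ v w → 0 < length v → Suffix v p → η (D w v u) ≡ sw)
  × (∀ v w → 0 < length v → Suffix v q → η (D w v u) ≡ se)
  × (∀ v w → 0 < length v → ¬ Suffix v p → ¬ Suffix v q → η (D w v u) ≡ down)

U-∷ʳ-false : ∀ u v w → U u v (w ∷ʳ false) ≡ U u v w
U-∷ʳ-false u v w = cong (λ xs → ⟨ lamps xs (norm (reverse u)) , + length v ⟩)
  (trans (cong norm (sym (List.++-assoc v w (false ∷ [])))) (norm-∷ʳ-false (v ++ w)))

upsideDown≡sea : ∀ {x} → upsideDown x ≡ sea → x ≡ sea
upsideDown≡sea {x} eq = trans (sym (upsideDown-involutive x)) (cong upsideDown eq)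

module _ (η : Config) (Ω : InΩ η) where

  tile-U : ∀ u v c w → Tile (η (U u v (c ∷ w))) (η (U u v (not c ∷ w)))
                            (η (U u (v ∷ʳ c) w)) (η (U u (v ∷ʳ not c) w))
  tile-U u v c w = subst (λ T → T) (cell-U u v c w η) (Equivalence.to (InΩ⇔cells η) Ω _)

  toggle-invariant : ∀ u v x c y → AtOrAboveSea (η (U u v (x ++ c ∷ y))) →
                     η (U u v (x ++ not c ∷ y)) ≡ η (U u v (x ++ c ∷ y))
  toggle-invariant u v []       c y above = proj₁ (tile-above-sea above (tile-U u v c y))
  toggle-invariant u v (x ∷ xs) c y above =
    let _ , top₁ , top₂ = tile-above-sea above (tile-U u v x (xs ++ c ∷ y))
    in sym (tile-bottom-unique top₁
              (toggle-invariant u (v ∷ʳ x) xs c y (inj₂ top₁))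
              (toggle-invariant u (v ∷ʳ not x) xs c y (inj₂ top₂))
              (tile-U u v x (xs ++ c ∷ y)) (tile-U u v x (xs ++ not c ∷ y)))

  tail-irrelevant : ∀ u v {w} → Reverse w → AtOrAboveSea (η (U u v [])) →
                    η (U u v w) ≡ η (U u v [])
  tail-irrelevant u v []              above = refl
  tail-irrelevant u v (ws ∶ rs ∶ʳ c) above =
    trans (drop-last c) (tail-irrelevant u v rs above)
    where
    drop-false : η (U u v (ws ∷ʳ false)) ≡ η (U u v ws)
    drop-false = cong η (U-∷ʳ-false u v ws)
    drop-last : ∀ c → η (U u v (ws ∷ʳ c)) ≡ η (U u v ws)
    drop-last false = drop-false
    drop-last true  = trans (toggle-invariant u v ws false [] above-sea) drop-false
      where
      above-sea : AtOrAboveSea (η (U u v (ws ∷ʳ false)))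
      above-sea = subst AtOrAboveSea (sym (trans drop-false (tail-irrelevant u v rs above))) above

C-right-sea : ∀ η → InΩ η → η e ≡ sea → ∀ v → η (C [] v) ≡ sea
C-right-sea η Ω e-sea v = trans (tail-irrelevant η Ω [] [] (reverseView v) (inj₁ e-sea)) e-sea

-- C u [] is the mirror image of C [] (reverse u).
C-sea : ∀ η → InΩ η → η e ≡ sea → ∀ u v → η (C u v) ≡ sea
C-sea η Ω e-sea u v = trans (tail-irrelevant η Ω u [] (reverseView v) (inj₁ left-sea)) left-sea
  where
  left-sea : η (C u []) ≡ sea
  left-sea = upsideDown≡sea (C-right-sea (dual η) (InΩ-dual η Ω) (cong upsideDown e-sea) (reverse u))

U-above-sea : ∀ η → InΩ η → η e ≡ sea → ∀ u {v} → Reverse v → AtOrAboveSea (η (U u v []))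
U-above-sea η Ω e-sea u []              = inj₁ (C-sea η Ω e-sea u [])
U-above-sea η Ω e-sea u (vs ∶ rs ∶ʳ c) =
  inj₂ (proj₁ (proj₂ (tile-above-sea (subst AtOrAboveSea (sym bottom≡) below) (tile-U η Ω u vs c []))))
  where
  below = U-above-sea η Ω e-sea u rs
  bottom≡ : η (U u vs (c ∷ [])) ≡ η (U u vs [])
  bottom≡ = tail-irrelevant η Ω u vs (reverseView (c ∷ [])) below

upper-words : ∀ η → InΩ η → η e ≡ sea → ∀ u → ∃[ p ] ∃[ q ] p 0 ≢ q 0 × UpperRules η u p q
upper-words η Ω e-sea u =
  let p , q , p≢q , r₁ , r₂ , r₃ = SeaRootedTree.tree-rules F (C-sea η Ω e-sea u []) node
  in p , q , p≢q ,
     (λ v w 0<∣v∣ P → trans (tail v w) (r₁ v 0<∣v∣ P)) ,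
     (λ v w 0<∣v∣ Q → trans (tail v w) (r₂ v 0<∣v∣ Q)) ,
     (λ v w 0<∣v∣ ¬P ¬Q → trans (tail v w) (r₃ v 0<∣v∣ ¬P ¬Q))
  where
  F : List Bool → A
  F v = η (U u v [])
  tail : ∀ v w → η (U u v w) ≡ F v
  tail v w = tail-irrelevant η Ω u v (reverseView w) (U-above-sea η Ω e-sea u (reverseView v))
  node : ∀ v → ∃[ β ] Tile (F v) β (F (v ∷ʳ false)) (F (v ∷ʳ true))
  node v = _ , subst (λ x → Tile x (η (U u v (true ∷ []))) (F (v ∷ʳ false)) (F (v ∷ʳ true)))
                     (tail v (false ∷ [])) (tile-U η Ω u v false [])

lower-of-dual : ∀ η u p q → UpperRules (dual η) (reverse u) p q → LowerRules η u p q
lower-of-dual η u p q (r₁ , r₂ , r₃) =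
  (λ v w 0<∣v∣ P → via-dual v w (r₁ (reverse v) (reverse w) (nonempty-reverse v 0<∣v∣) P)) ,
  (λ v w 0<∣v∣ Q → via-dual v w (r₂ (reverse v) (reverse w) (nonempty-reverse v 0<∣v∣) Q)) ,
  (λ v w 0<∣v∣ ¬P ¬Q → via-dual v w (r₃ (reverse v) (reverse w) (nonempty-reverse v 0<∣v∣) ¬P ¬Q))
  where
  nonempty-reverse : ∀ (v : List Bool) → 0 < length v → 0 < length (reverse v)
  nonempty-reverse v = subst (0 <_) (sym (List.length-reverse v))
  via-dual : ∀ v w {x} → dual η (U (reverse u) (reverse v) (reverse w)) ≡ x →
             η (D w v u) ≡ upsideDown x
  via-dual v w eq = begin
    η (D w v u)                                  ≡⟨ upsideDown-involutive _ ⟨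
    upsideDown (upsideDown (η (D w v u)))        ≡⟨ cong (upsideDown ∘ upsideDown ∘ η) mirrored ⟩
    upsideDown (dual η (U (reverse u) (reverse v) (reverse w))) ≡⟨ cong upsideDown eq ⟩
    upsideDown _                                 ∎
    where
    open ≡-Reasoning
    mirrored : D w v u ≡ mirror (U (reverse u) (reverse v) (reverse w))
    mirrored = trans (sym (mirror-involutive (D w v u))) (cong mirror (mirror-D w v u))

upper-of-dual : ∀ η u p q → LowerRules η (reverse u) p q → UpperRules (dual η) u p q
upper-of-dual η u p q (r₁ , r₂ , r₃) =
  (λ v w 0<∣v∣ P → via-mirror v w (r₁ (reverse v) (reverse w) (nonempty-reverse v 0<∣v∣) (prefix v {p} P))) ,
  (λ v w 0<∣v∣ Q → via-mirror v w (r₂ (reverse v) (reverse w) (nonempty-reverse v 0<∣v∣) (prefix v {q} Q))) ,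
  (λ v w 0<∣v∣ ¬P ¬Q → via-mirror v w (r₃ (reverse v) (reverse w) (nonempty-reverse v 0<∣v∣)
                                          (¬P ∘ unprefix v {p}) (¬Q ∘ unprefix v {q})))
  where
  nonempty-reverse : ∀ (v : List Bool) → 0 < length v → 0 < length (reverse v)
  nonempty-reverse v = subst (0 <_) (sym (List.length-reverse v))
  prefix : ∀ v {s} → Prefix v s → Suffix (reverse v) s
  prefix v {s} = subst (λ x → Prefix x s) (sym (List.reverse-involutive v))
  unprefix : ∀ v {s} → Suffix (reverse v) s → Prefix v s
  unprefix v {s} = subst (λ x → Prefix x s) (List.reverse-involutive v)
  via-mirror : ∀ v w {x} → η (D (reverse w) (reverse v) (reverse u)) ≡ x →
               dual η (U u v w) ≡ upsideDown x
  via-mirror v w eq = cong upsideDown (trans (cong η (mirror-U u v w)) eq)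

InΩ⇒characterization : ∀ η → InΩ η → η e ≡ sea → Characterization η
InΩ⇒characterization η Ω e-sea = C-sea η Ω e-sea , words
  where
  words : ∀ u → Σ Words λ S → snw S 0 ≢ sne S 0 × ssw S 0 ≢ sse S 0 × Rules η u S
  words u =
    let p , q , p≢q , r₁ , r₂ , r₃ = upper-words η Ω e-sea u
        p′ , q′ , p′≢q′ , dual-rules =
          upper-words (dual η) (InΩ-dual η Ω) (cong upsideDown e-sea) (reverse u)
        r₄ , r₅ , r₆ = lower-of-dual η u p′ q′ dual-rules
    in record { snw = p ; sne = q ; ssw = p′ ; sse = q′ } ,
       p≢q , p′≢q′ , r₁ , r₂ , r₃ , r₄ , r₅ , r₆

-- Configurations prescribed by the words

arrow : Bool → Bool → A
arrow P Q = if P then nw else if Q then ne else up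

label : (ℕ → Bool) → (ℕ → Bool) → List Bool → A
label p q v = arrow (does (Prefix? v p)) (does (Prefix? v q))

does-true : ∀ {X : Set} (x? : Dec X) → does x? ≡ true → X
does-true (yes x) _ = x

does-Prefix?-∷ʳ : ∀ v c s → does (Prefix? (v ∷ʳ c) s) ≡ does (Prefix? v s) ∧ does (c ≟ᵇ s (length v))
does-Prefix?-∷ʳ v c s = does-⇔ (Prefix-∷ʳ v c s) (Prefix? (v ∷ʳ c) s) (Prefix? v s ×-dec (c ≟ᵇ s (length v)))

rules⇒label : ∀ η u p q → UpperRules η u p q → ∀ v w → 0 < length v → η (U u v w) ≡ label p q v
rules⇒label η u p q (r₁ , r₂ , r₃) v w 0<∣v∣ with Prefix? v p | Prefix? v q
... | yes P | _     = r₁ v w 0<∣v∣ P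
... | no ¬P | yes Q = r₂ v w 0<∣v∣ Q
... | no ¬P | no ¬Q = r₃ v w 0<∣v∣ ¬P ¬Q

arrow-tile : ∀ P Q c x y → ¬ (P ≡ true × Q ≡ true) →
  Tile (arrow P Q) (arrow P Q)
       (arrow (P ∧ does (c ≟ᵇ x)) (Q ∧ does (c ≟ᵇ y)))
       (arrow (P ∧ does (not c ≟ᵇ x)) (Q ∧ does (not c ≟ᵇ y)))
arrow-tile false false _     _     _     _ = up-up-up-up
arrow-tile true  true  _     _     _     h = ⊥-elim (h (refl , refl))
arrow-tile true  false true  true  _     _ = nw-nw-nw-up
arrow-tile true  false true  false _     _ = nw-nw-up-nw
arrow-tile true  false false true  _     _ = nw-nw-up-nw
arrow-tile true  false false false _     _ = nw-nw-nw-up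
arrow-tile false true  true  _     true  _ = ne-ne-ne-up
arrow-tile false true  true  _     false _ = ne-ne-up-ne
arrow-tile false true  false _     true  _ = ne-ne-up-ne
arrow-tile false true  false _     false _ = ne-ne-ne-up

arrow-root : ∀ c x y → x ≢ y →
  Tile sea sea (arrow (does (c ≟ᵇ x)) (does (c ≟ᵇ y))) (arrow (does (not c ≟ᵇ x)) (does (not c ≟ᵇ y)))
arrow-root true  true  true  x≢y = ⊥-elim (x≢y refl)
arrow-root true  true  false _   = sea-sea-nw-ne
arrow-root true  false true  _   = sea-sea-ne-nw
arrow-root true  false false x≢y = ⊥-elim (x≢y refl)
arrow-root false true  true  x≢y = ⊥-elim (x≢y refl)
arrow-root false true  false _   = sea-sea-ne-nw
arrow-root false false true  _   = sea-sea-nw-ne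
arrow-root false false false x≢y = ⊥-elim (x≢y refl)

module _ (p q : ℕ → Bool) (p≢q : p 0 ≢ q 0) where

  label-root-tile : ∀ c → Tile sea sea (label p q (c ∷ [])) (label p q (not c ∷ []))
  label-root-tile c
    rewrite does-Prefix?-∷ʳ [] c p | does-Prefix?-∷ʳ [] c q
          | does-Prefix?-∷ʳ [] (not c) p | does-Prefix?-∷ʳ [] (not c) q = arrow-root c (p 0) (q 0) p≢q

  label-tile : ∀ v c → 0 < length v →
               Tile (label p q v) (label p q v) (label p q (v ∷ʳ c)) (label p q (v ∷ʳ not c))
  label-tile v c 0<∣v∣
    rewrite does-Prefix?-∷ʳ v c p | does-Prefix?-∷ʳ v c q
          | does-Prefix?-∷ʳ v (not c) p | does-Prefix?-∷ʳ v (not c) q =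
    arrow-tile _ _ c (p (length v)) (q (length v)) λ (P , Q) →
      p≢q (prefix-heads v p q 0<∣v∣ (does-true (Prefix? v p) P) (does-true (Prefix? v q) Q))

module _ (η : Config) (C≡sea : ∀ u v → η (C u v) ≡ sea)
         (p q : List Bool → ℕ → Bool) (rules : ∀ u → UpperRules η u (p u) (q u)) where

  private
    label≡ : ∀ u v w → 0 < length v → η (U u v w) ≡ label (p u) (q u) v
    label≡ u = rules⇒label η u (p u) (q u) (rules u)

  tile-U-from-rules : (∀ u → p u 0 ≢ q u 0) → ∀ u v c w →
    Tile (η (U u v (c ∷ w))) (η (U u v (not c ∷ w))) (η (U u (v ∷ʳ c) w)) (η (U u (v ∷ʳ not c) w))
  tile-U-from-rules p≢q u [] c w =
    subst (λ T → T) (sym (Tile-≡ (C≡sea u (c ∷ w)) (C≡sea u (not c ∷ w))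
                                 (label≡ u (c ∷ []) w (s≤s z≤n)) (label≡ u (not c ∷ []) w (s≤s z≤n))))
          (label-root-tile (p u) (q u) (p≢q u) c)
  tile-U-from-rules p≢q u (x ∷ v) c w =
    subst (λ T → T) (sym (Tile-≡ (label≡ u (x ∷ v) (c ∷ w) (s≤s z≤n)) (label≡ u (x ∷ v) (not c ∷ w) (s≤s z≤n))
                                 (label≡ u (x ∷ v ∷ʳ c) w (s≤s z≤n)) (label≡ u (x ∷ v ∷ʳ not c) w (s≤s z≤n))))
          (label-tile (p u) (q u) (p≢q u) (x ∷ v) c (s≤s z≤n))

  cells-above-sea : (∀ u → p u 0 ≢ q u 0) → ∀ s n → Cell η ⟨ s , + n ⟩
  cells-above-sea p≢q s n with U-coordinates s n
  ... | u , v , c , w , g≡U =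
    subst (Cell η) (sym g≡U) (subst (λ T → T) (sym (cell-U u v c w η)) (tile-U-from-rules p≢q u v c w))

  agree-above-sea : ∀ η′ → (∀ u v → η′ (C u v) ≡ sea) → (∀ u → UpperRules η′ u (p u) (q u)) →
                    ∀ s n → η ⟨ s , + n ⟩ ≡ η′ ⟨ s , + n ⟩
  agree-above-sea η′ C≡sea′ rules′ s n with U-coordinates s n
  ... | u , v , c , w , g≡U = trans (cong η g≡U) (trans (agree-U v) (cong η′ (sym g≡U)))
    where
    agree-U : ∀ v → η (U u v (c ∷ w)) ≡ η′ (U u v (c ∷ w))
    agree-U []      = trans (C≡sea u (c ∷ w)) (sym (C≡sea′ u (c ∷ w)))
    agree-U (x ∷ v) = trans (label≡ u (x ∷ v) (c ∷ w) (s≤s z≤n))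
                        (sym (rules⇒label η′ u (p u) (q u) (rules′ u) (x ∷ v) (c ∷ w) (s≤s z≤n)))

dual-C-sea : ∀ η → (∀ u v → η (C u v) ≡ sea) → ∀ u v → dual η (C u v) ≡ sea
dual-C-sea η C≡sea u v = cong upsideDown (trans (cong η (mirror-C u v)) (C≡sea (reverse v) (reverse u)))

module _ (η : Config) (S : List Bool → Words) (R : ∀ u → Rules η u (S u)) where

  upper-rules : ∀ u → UpperRules η u (snw (S u)) (sne (S u))
  upper-rules u = let r₁ , r₂ , r₃ , _ = R u in r₁ , r₂ , r₃

  dual-upper-rules : ∀ u → UpperRules (dual η) u (ssw (S (reverse u))) (sse (S (reverse u)))
  dual-upper-rules u = let _ , _ , _ , lower = R (reverse u)
                       in upper-of-dual η u (ssw (S (reverse u))) (sse (S (reverse u))) lower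

characterization⇒InΩ : ∀ η → Characterization η → InΩ η
characterization⇒InΩ η (C≡sea , words) = Equivalence.from (InΩ⇔cells η) cells
  where
  S = proj₁ ∘ words
  R : ∀ u → Rules η u (S u)
  R u = let _ , _ , _ , rules = words u in rules
  cells : ∀ g → Cell η g
  cells ⟨ s , + n ⟩ =
    cells-above-sea η C≡sea (snw ∘ S) (sne ∘ S) (upper-rules η S R) (proj₁ ∘ proj₂ ∘ words) s n
  cells ⟨ s , -[1+ n ] ⟩ = cell-cong (dual-involutive η) _ (cell-dual (dual η) s -[1+ n ]
    (cells-above-sea (dual η) (dual-C-sea η C≡sea) (ssw ∘ S ∘ reverse) (sse ∘ S ∘ reverse)
                     (dual-upper-rules η S R) (proj₁ ∘ proj₂ ∘ proj₂ ∘ words ∘ reverse) (mirrorLamps s) n))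

determined-by-words : ∀ (η η′ : Config) → η e ≡ sea → η′ e ≡ sea → InΩ η → InΩ η′
  → (S : List Bool → Words)
  → (∀ u → Rules η u (S u)) → (∀ u → Rules η′ u (S u))
  → ∀ g → η g ≡ η′ g
determined-by-words η η′ e-sea e-sea′ Ω Ω′ S R R′ ⟨ s , + n ⟩ =
  agree-above-sea η (C-sea η Ω e-sea) (snw ∘ S) (sne ∘ S) (upper-rules η S R)
                  η′ (C-sea η′ Ω′ e-sea′) (upper-rules η′ S R′) s n
determined-by-words η η′ e-sea e-sea′ Ω Ω′ S R R′ ⟨ s , -[1+ n ] ⟩ = begin
  η ⟨ s , -[1+ n ] ⟩                                ≡⟨ dual-involutive η _ ⟨
  upsideDown (dual η ⟨ mirrorLamps s , + suc n ⟩)  ≡⟨ cong upsideDown agree ⟩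
  upsideDown (dual η′ ⟨ mirrorLamps s , + suc n ⟩) ≡⟨ dual-involutive η′ _ ⟩
  η′ ⟨ s , -[1+ n ] ⟩                               ∎
  where
  open ≡-Reasoning
  agree = agree-above-sea (dual η) (dual-C-sea η (C-sea η Ω e-sea))
            (ssw ∘ S ∘ reverse) (sse ∘ S ∘ reverse) (dual-upper-rules η S R)
            (dual η′) (dual-C-sea η′ (C-sea η′ Ω′ e-sea′)) (dual-upper-rules η′ S R′)
            (mirrorLamps s) (suc n)

lemma6p6 : (∀ (η : Config) → η e ≡ sea → (InΩ η ⇔ Characterization η))
    × (∀ (η η′ : Config) → η e ≡ sea → η′ e ≡ sea → InΩ η → InΩ η′
        → (S : List Bool → Words)
        → (∀ u → Rules η u (S u)) → (∀ u → Rules η′ u (S u))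
        → ∀ g → η g ≡ η′ g)
lemma6p6 =
  (λ η e-sea → mk⇔ (λ Ω → InΩ⇒characterization η Ω e-sea) (characterization⇒InΩ η)) ,
  determined-by-words
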